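{- Let $m\in P_n=\mathbf{Q}[x_1,\dots,x_n]$ be a monomial and $1\le k\le n$. Let $S^{(k)}$ be the set of monomials appearing in the expansion of $m\cdot e_k$, where $e_k$ is the $k$-th elementary symmetric polynomial, and let $m^{(k)}:=m\cdot x_{\pi(1)}x_{\pi(2)}\cdots x_{\pi(k)}$ where $\pi=\pi(m)$. Then (1) $m^{(k)}\in S^{(k)}$, and (2) if $m'\in S^{(k)}$ and $m'\ne m^{(k)}$ then $m'\prec m^{(k)}$.
   Context: For a monomial $m=\prod x_i^{p_i}$: its index permutation $\pi(m)\in S_n$ is the unique $\pi$ with $p_{\pi(i)}\ge p_{\pi(i+1)}$ and $\pi(i)<\pi(i+1)$ whenever $p_{\pi(i)}=p_{\pi(i+1)}$; its exponent partition is $\lambda(m)=(p_{\pi(1)},\dots,p_{\pi(n)})$. For monomials $m_1,m_2$ of the same total degree, $m_1\prec m_2$ if either $\lambda(m_1)$ is strictly dominated by $\lambda(m_2)$ in dominance order, or $\lambda(m_1)=\lambda(m_2)$ and ${\it inv}(\pi(m_1))>{\it inv}(\pi(m_2))$, with ${\it inv}$ the number of inversions. -}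

module Defs where

open import Data.Nat using (ℕ; zero; suc; _+_; _≤_; _<_; _≤ᵇ_)
open import Data.Bool using (Bool; true; false; if_then_else_)
open import Data.Fin using (Fin; toℕ)
open import Data.Fin.Properties using () renaming (_<?_ to _<ᶠ?_)
open import Data.Fin.Subset using (Subset; _∈_; ∣_∣)
open import Data.List using (List; []; _∷_; foldr; map; take; filter; length)
open import Data.Nat.ListAction using (sum)
open import Data.Vec using (Vec; lookup; zipWith; replicate; toList; tabulate; _[_]%=_)
open import Data.Product using (Σ; _×_)
open import Data.Sum using (_⊎_)
open import Relation.Binary.PropositionalEquality using (_≡_; _≢_)

-- A monomial x₁^{p₁}⋯xₙ^{pₙ} is represented by its exponent vector (p₁,…,pₙ).
Monomial : ℕ → Set
Monomial n = Vec ℕ n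

deg : ∀ {n} → Monomial n → ℕ
deg m = sum (toList m)

_·_ : ∀ {n} → Monomial n → Monomial n → Monomial n
_·_ = zipWith _+_

xList : ∀ {n} → List (Fin n) → Monomial n
xList {n} = foldr (λ i v → v [ i ]%= suc) (replicate n 0)

xSub : ∀ {n} → Subset n → Monomial n
xSub S = tabulate (λ i → if lookup S i then 1 else 0)

-- Index permutation π(m), as the list (π(1),…,π(n)) of indices:
-- stable sort of the indices 1..n by decreasing exponent (insertion sort;
-- ties are kept in increasing order of index).
insIdx : ∀ {n} → Monomial n → Fin n → List (Fin n) → List (Fin n)
insIdx m i [] = i ∷ []
insIdx m i (j ∷ js) =
  if lookup m j ≤ᵇ lookup m i then i ∷ j ∷ js else j ∷ insIdx m i js

allIdx : (n : ℕ) → List (Fin n)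
allIdx n = toList (tabulate {n = n} (λ i → i))

indexPerm : ∀ {n} → Monomial n → List (Fin n)
indexPerm {n} m = foldr (insIdx m) [] (allIdx n)

expPart : ∀ {n} → Monomial n → List ℕ
expPart m = map (lookup m) (indexPerm m)

inv : ∀ {n} → List (Fin n) → ℕ
inv [] = 0
inv (x ∷ xs) = length (filter (_<ᶠ? x) xs) + inv xs

_⊴_ : List ℕ → List ℕ → Set
λ₁ ⊴ λ₂ = ∀ j → sum (take j λ₁) ≤ sum (take j λ₂)

_◁_ : List ℕ → List ℕ → Set
λ₁ ◁ λ₂ = (λ₁ ⊴ λ₂) × (λ₁ ≢ λ₂)

_≺_ : ∀ {n} → Monomial n → Monomial n → Set
m₁ ≺ m₂ = (deg m₁ ≡ deg m₂) ×
  ((expPart m₁ ◁ expPart m₂) ⊎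
   ((expPart m₁ ≡ expPart m₂) × (inv (indexPerm m₂) < inv (indexPerm m₁))))

-- e_k = Σ_{S ⊆ [n], |S| = k} x_S, all coefficients 1; hence the monomials
-- appearing in m · e_k are exactly the m · x_S with |S| = k.
InSk : ∀ {n} → Monomial n → ℕ → Monomial n → Set
InSk {n} m k m′ = Σ (Subset n) (λ S → (∣ S ∣ ≡ k) × (m′ ≡ m · xSub S))

mk : ∀ {n} → Monomial n → ℕ → Monomial n
mk m k = m · xList (take k (indexPerm m))

{-# OPTIONS --safe #-}
module Submission where

-- The monomials of m · e_k are the m · x_S with |S| = k; let T be the first k indices of π(m), so
-- that m^(k) = m · x_T. Where S and T disagree on x₁, first
-- replace S on the remaining variables by the optimum given by induction; the result and m · x_T
-- then differ only in whether one unit of exponent sits on x₁ or on the variable x_j that the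
-- top k of x₂, …, xₙ has beyond its top k − 1, and T puts it on the larger of the two exponents
-- (on x₁ in a tie). Moving a unit from a smaller exponent onto a strictly larger one raises the
-- exponent partition strictly in dominance order; moving it between equal exponents onto the
-- earlier variable keeps the partition and lowers the number of inversions of π.

open import Defs
open import Data.Bool using (true; false; if_then_else_)
open import Data.Empty using (⊥-elim)
open import Data.Fin as Fin using (Fin)
open import Data.Fin.Properties using () renaming (_<?_ to _<ᶠ?_)
open import Data.Fin.Subset using (Subset; ∣_∣)
open import Data.Fin.Subset.Properties using (∣p∣≤n)
open import Data.List using (List; []; _∷_; _++_; map; take; filter; length; foldr)
open import Data.List.Properties
  using (take-[]; take-map; map-∘; foldr-map; foldr-fusion; length-filter; filter-none)
open import Data.List.Relation.Binary.Permutation.Propositional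
  using (_↭_; prep; swap; ↭-refl; ↭-trans; ↭-sym; ↭⇒↭ₛ′)
open import Data.List.Relation.Binary.Permutation.Propositional.Properties
  using (shift; map⁺; filter-↭; ↭-length)
open import Data.List.Relation.Binary.Pointwise as Pointwise using (Pointwise-≡⇒≡)
open import Data.List.Relation.Unary.All as All using ()
open import Data.List.Relation.Unary.Linked as Linked using ([]; _∷_)
open import Data.List.Relation.Unary.Linked.Properties using (Linked⇒All)
open import Data.Nat using (ℕ; zero; suc; pred; _+_; _*_; _⊔_; _≤_; _<_; _≤ᵇ_; _<ᵇ_; z≤n; s≤s)
open import Data.Nat.ListAction using (sum)
open import Data.Nat.ListAction.Properties using (sum-↭)
open import Data.Nat.Properties
open import Data.Nat.Tactic.RingSolver using (solve-∀)
open import Algebra.Properties.CommutativeSemigroup +-commutativeSemigroup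
  using () renaming (interchange to +-interchange; x∙yz≈y∙xz to +-left-comm)
open import Data.Product using (_×_; _,_)
open import Data.Sum using (_⊎_; inj₁; inj₂)
open import Data.Vec using (Vec; []; _∷_; toList; lookup; tabulate; _[_]%=_)
open import Data.Vec.Properties using (toList-injective; cast-is-id; length-toList; toList-map; tabulate-∘)
open import Function using (_∘_; id)
open import Level using (0ℓ)
open import Relation.Binary using (DecTotalOrder; tri<; tri≈; tri>)
import Relation.Binary.Construct.Flip.Ord as Flip
open import Relation.Binary.PropositionalEquality
open import Relation.Nullary using (yes; no; does; contradiction)
open import Relation.Nullary.Decidable using (dec-true; dec-false)

≤ᵇ-true : ∀ {m n} → m ≤ n → (m ≤ᵇ n) ≡ true
≤ᵇ-true {m} {n} = dec-true (m ≤? n)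

≤ᵇ-false : ∀ {m n} → n < m → (m ≤ᵇ n) ≡ false
≤ᵇ-false {m} {n} n<m = dec-false (m ≤? n) (<⇒≱ n<m)

<ᵇ-true : ∀ {m n} → m < n → (m <ᵇ n) ≡ true
<ᵇ-true {m} {n} = dec-true (m <? n)

<ᵇ-false : ∀ {m n} → n ≤ m → (m <ᵇ n) ≡ false
<ᵇ-false {m} {n} n≤m = dec-false (m <? n) (≤⇒≯ n≤m)

-- Decreasing insertion sort: `insert x (y ∷ ys)` tests `y ≤ᵇ x`, the same test as `insIdx`.
≥-decTotalOrder : DecTotalOrder 0ℓ 0ℓ 0ℓ
≥-decTotalOrder = Flip.decTotalOrder ≤-decTotalOrder

open DecTotalOrder ≥-decTotalOrder using (module Eq) renaming (trans to ≥-trans; totalOrder to ≥-totalOrder)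
open import Data.List.Sort.InsertionSort.Base ≥-decTotalOrder using (insert; sort)
open import Data.List.Sort.InsertionSort.Properties ≥-decTotalOrder using (sort-↭; sort-↗; insert-↗)
open import Data.List.Relation.Unary.Sorted.TotalOrder ≥-totalOrder using (Sorted)
open import Data.List.Relation.Unary.Sorted.TotalOrder.Properties using (↗↭↗⇒≋)

insert-≤ : ∀ {x y} ys → y ≤ x → insert x (y ∷ ys) ≡ x ∷ y ∷ ys
insert-≤ ys y≤x rewrite ≤ᵇ-true y≤x = refl

insert-> : ∀ {x y} ys → x < y → insert x (y ∷ ys) ≡ y ∷ insert x ys
insert-> ys x<y rewrite ≤ᵇ-false x<y = refl

sort-cong-↭ : ∀ {xs ys} → xs ↭ ys → sort xs ≡ sort ys
sort-cong-↭ {xs} {ys} xs↭ys = Pointwise-≡⇒≡ (Pointwise.map sym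
  (↗↭↗⇒≋ ≥-totalOrder (sort-↗ xs) (sort-↗ ys)
    (↭⇒↭ₛ′ Eq.isEquivalence (↭-trans (sort-↭ xs) (↭-trans xs↭ys (↭-sym (sort-↭ ys)))))))

sort-≡⇒↭ : ∀ xs ys → sort xs ≡ sort ys → xs ↭ ys
sort-≡⇒↭ xs ys eq = ↭-trans (↭-sym (sort-↭ xs)) (subst (_↭ ys) (sym eq) (sort-↭ ys))

∷-shift : ∀ {A : Set} (x y : A) M R → x ∷ M ++ y ∷ R ↭ y ∷ x ∷ M ++ R
∷-shift x y M R = ↭-trans (prep x (shift y M R)) (swap x y ↭-refl)

prefixSum : ℕ → List ℕ → ℕ
prefixSum j xs = sum (take j xs)

prefixSum-[] : ∀ j → prefixSum j [] ≡ 0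
prefixSum-[] j = cong sum (take-[] j)

prefixSum-suc-≤ : ∀ {x : ℕ} {xs : List ℕ} j → Sorted (x ∷ xs) →
  prefixSum (suc j) xs ≤ prefixSum j xs + x
prefixSum-suc-≤ {xs = []} j _ = z≤n
prefixSum-suc-≤ {x} {y ∷ ys} zero (y≤x ∷ _) rewrite +-identityʳ y = y≤x
prefixSum-suc-≤ {x} {y ∷ ys} (suc j) (y≤x ∷ s) = begin
  y + prefixSum (suc j) ys   ≤⟨ +-monoʳ-≤ y (prefixSum-suc-≤ j s) ⟩
  y + (prefixSum j ys + y)   ≤⟨ +-monoʳ-≤ y (+-monoʳ-≤ (prefixSum j ys) y≤x) ⟩
  y + (prefixSum j ys + x)   ≡⟨ +-assoc y _ x ⟨
  y + prefixSum j ys + x     ∎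
  where open ≤-Reasoning

prefixSum-insert : ∀ x j {xs : List ℕ} → Sorted xs →
  prefixSum (suc j) (insert x xs) ≡ prefixSum (suc j) xs ⊔ (prefixSum j xs + x)
prefixSum-insert x j {[]} _ rewrite prefixSum-[] j = +-identityʳ x
prefixSum-insert x j {y ∷ ys} s with y ≤? x
... | yes y≤x rewrite insert-≤ ys y≤x =
  sym (trans (m≤n⇒m⊔n≡n (prefixSum-suc-≤ j (y≤x ∷ s))) (+-comm _ x))
... | no y≰x rewrite insert-> ys (≰⇒> y≰x) with j
...   | zero = sym (m≥n⇒m⊔n≡m (≤-trans (<⇒≤ (≰⇒> y≰x)) (m≤m+n y 0)))
...   | suc j = begin
  y + prefixSum (suc j) (insert x ys)
    ≡⟨ cong (y +_) (prefixSum-insert x j (Linked.tail s)) ⟩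
  y + (prefixSum (suc j) ys ⊔ (prefixSum j ys + x))
    ≡⟨ +-distribˡ-⊔ y _ _ ⟩
  (y + prefixSum (suc j) ys) ⊔ (y + (prefixSum j ys + x))
    ≡⟨ cong ((y + prefixSum (suc j) ys) ⊔_) (+-assoc y _ x) ⟨
  (y + prefixSum (suc j) ys) ⊔ (y + prefixSum j ys + x)
    ∎
  where open ≡-Reasoning

prefixSum-≤-insert : ∀ x j {xs : List ℕ} → Sorted xs → prefixSum j xs ≤ prefixSum j (insert x xs)
prefixSum-≤-insert x zero s = z≤n
prefixSum-≤-insert x (suc j) s rewrite prefixSum-insert x j s = m≤m⊔n _ _

prefixSum-+-≤-insert : ∀ x j {xs : List ℕ} → Sorted xs →
  prefixSum j xs + x ≤ prefixSum (suc j) (insert x xs)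
prefixSum-+-≤-insert x j s rewrite prefixSum-insert x j s = m≤n⊔m _ _

insert-mono-⊴ : ∀ x {xs ys : List ℕ} → Sorted xs → Sorted ys → xs ⊴ ys → insert x xs ⊴ insert x ys
insert-mono-⊴ x sx sy xs⊴ys zero = z≤n
insert-mono-⊴ x sx sy xs⊴ys (suc j) rewrite prefixSum-insert x j sx | prefixSum-insert x j sy =
  ⊔-mono-≤ (xs⊴ys (suc j)) (+-monoˡ-≤ x (xs⊴ys j))

prefixSum-insert-suc-≤ : ∀ B j {xs : List ℕ} → Sorted xs →
  prefixSum j (insert (suc B) xs) ≤ suc (prefixSum j (insert B xs))
prefixSum-insert-suc-≤ B zero s = z≤n
prefixSum-insert-suc-≤ B (suc j) {xs} s
  rewrite prefixSum-insert (suc B) j s | prefixSum-insert B j s | +-suc (prefixSum j xs) B =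
  ⊔-lub (≤-trans (m≤m⊔n _ _) (n≤1+n _)) (s≤s (m≤n⊔m _ _))

insert-transfer-⊴ : ∀ {A B : ℕ} {xs : List ℕ} → B ≤ A → Sorted xs →
  insert A (insert (suc B) xs) ⊴ insert (suc A) (insert B xs)
insert-transfer-⊴ B≤A s zero = z≤n
insert-transfer-⊴ {A} {B} {xs} B≤A s (suc j) = begin
  prefixSum (suc j) (insert A ys)                 ≡⟨ prefixSum-insert A j (insert-↗ (suc B) s) ⟩
  prefixSum (suc j) ys ⊔ (prefixSum j ys + A)     ≤⟨ ⊔-lub ys-part A-part ⟩
  prefixSum (suc j) (insert (suc A) zs)           ∎
  where
  open ≤-Reasoning
  ys = insert (suc B) xs
  zs = insert B xs
  zs↗ = insert-↗ B s

  ys-part : prefixSum (suc j) ys ≤ prefixSum (suc j) (insert (suc A) zs)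
  ys-part = begin
    prefixSum (suc j) ys                              ≡⟨ prefixSum-insert (suc B) j s ⟩
    prefixSum (suc j) xs ⊔ (prefixSum j xs + suc B)   ≤⟨ ⊔-lub
      (≤-trans (prefixSum-≤-insert B (suc j) s) (prefixSum-≤-insert (suc A) (suc j) zs↗))
      (≤-trans (+-mono-≤ (prefixSum-≤-insert B j s) (s≤s B≤A)) (prefixSum-+-≤-insert (suc A) j zs↗)) ⟩
    prefixSum (suc j) (insert (suc A) zs)             ∎

  A-part : prefixSum j ys + A ≤ prefixSum (suc j) (insert (suc A) zs)
  A-part = begin
    prefixSum j ys + A           ≤⟨ +-monoˡ-≤ A (prefixSum-insert-suc-≤ B j s) ⟩
    suc (prefixSum j zs) + A     ≡⟨ +-suc (prefixSum j zs) A ⟨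
    prefixSum j zs + suc A       ≤⟨ prefixSum-+-≤-insert (suc A) j zs↗ ⟩
    prefixSum (suc j) (insert (suc A) zs) ∎

squares : List ℕ → ℕ
squares xs = sum (map (λ x → x * x) xs)

above : ℕ → List ℕ → ℕ
above x ys = length (filter (x <?_) ys)

-- Pairs of positions i < j with xs_i < xs_j: exactly the inversions of the index permutation.
inversions : List ℕ → ℕ
inversions [] = 0
inversions (x ∷ xs) = above x xs + inversions xs

squares-↭ : ∀ {xs ys} → xs ↭ ys → squares xs ≡ squares ys
squares-↭ xs↭ys = sum-↭ (map⁺ _ xs↭ys)

above-↭ : ∀ {x xs ys} → xs ↭ ys → above x xs ≡ above x ys
above-↭ {x} xs↭ys = ↭-length (filter-↭ (x <?_) xs↭ys)

⟦_<_⟧ : ℕ → ℕ → ℕ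
⟦ x < y ⟧ = if x <ᵇ y then 1 else 0

⟦<⟧-≤1 : ∀ x y → ⟦ x < y ⟧ ≤ 1
⟦<⟧-≤1 x y with x <ᵇ y
... | true = ≤-refl
... | false = z≤n

⟦<⟧≡0 : ∀ {x y} → y ≤ x → ⟦ x < y ⟧ ≡ 0
⟦<⟧≡0 y≤x rewrite <ᵇ-false y≤x = refl

⟦<⟧-antiˡ : ∀ {a b} y → a ≤ b → ⟦ b < y ⟧ ≤ ⟦ a < y ⟧
⟦<⟧-antiˡ {a} {b} y a≤b with b <? y
... | yes b<y rewrite <ᵇ-true b<y | <ᵇ-true (≤-<-trans a≤b b<y) = ≤-refl
... | no b≮y rewrite <ᵇ-false (≮⇒≥ b≮y) = z≤n

⟦<⟧-monoʳ : ∀ {a b} y → a ≤ b → ⟦ y < a ⟧ ≤ ⟦ y < b ⟧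
⟦<⟧-monoʳ {a} {b} y a≤b with y <? a
... | yes y<a rewrite <ᵇ-true y<a | <ᵇ-true (<-≤-trans y<a a≤b) = ≤-refl
... | no y≮a rewrite <ᵇ-false (≮⇒≥ y≮a) = z≤n

above-∷ : ∀ x y ys → above x (y ∷ ys) ≡ ⟦ x < y ⟧ + above x ys
above-∷ x y ys with x <ᵇ y
... | true = refl
... | false = refl

above-∷-≤ : ∀ {x y} ys → y ≤ x → above x (y ∷ ys) ≡ above x ys
above-∷-≤ {x} {y} ys y≤x = trans (above-∷ x y ys) (cong (_+ above x ys) (⟦<⟧≡0 y≤x))

above-shift : ∀ x z M R → above x (M ++ z ∷ R) ≡ ⟦ x < z ⟧ + above x (M ++ R)
above-shift x z M R = trans (above-↭ (shift z M R)) (above-∷ x z (M ++ R))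

above-anti : ∀ {a b} ys → a ≤ b → above b ys ≤ above a ys
above-anti [] a≤b = z≤n
above-anti {a} {b} (y ∷ ys) a≤b rewrite above-∷ b y ys | above-∷ a y ys =
  +-mono-≤ (⟦<⟧-antiˡ y a≤b) (above-anti ys a≤b)

inversions-∷-∷ : ∀ x y zs → inversions (x ∷ y ∷ zs) ≡ ⟦ x < y ⟧ + above y zs + inversions (x ∷ zs)
inversions-∷-∷ x y zs rewrite above-∷ x y zs =
  +-interchange ⟦ x < y ⟧ (above x zs) (above y zs) (inversions zs)

inversions-swap : ∀ {a b} → a < b → ∀ M R →
  inversions (b ∷ M ++ a ∷ R) < inversions (a ∷ M ++ b ∷ R)
inversions-swap {a} {b} a<b [] R
  rewrite inversions-∷-∷ b a R | inversions-∷-∷ a b R | <ᵇ-false (<⇒≤ a<b) | <ᵇ-true a<b =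
  s≤s (≤-reflexive (+-left-comm (above a R) (above b R) (inversions R)))
inversions-swap {a} {b} a<b (m ∷ M) R
  rewrite inversions-∷-∷ b m (M ++ a ∷ R) | inversions-∷-∷ a m (M ++ b ∷ R)
        | above-shift m a M R | above-shift m b M R =
  +-mono-≤-<
    (+-mono-≤ (⟦<⟧-antiˡ m (<⇒≤ a<b)) (+-monoˡ-≤ (above m (M ++ R)) (⟦<⟧-monoʳ m (<⇒≤ a<b))))
    (inversions-swap a<b M R)

⊴-trans : ∀ {xs ys zs} → xs ⊴ ys → ys ⊴ zs → xs ⊴ zs
⊴-trans xs⊴ys ys⊴zs j = ≤-trans (xs⊴ys j) (ys⊴zs j)

infix 4 _⊏_ _⊑_

-- A strengthening of ≺ on exponent lists. Strict dominance is witnessed by a larger sum of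
-- squares instead of by `≢`, which makes ⊏ transitive without antisymmetry of ⊴.
data _⊏_ (xs ys : List ℕ) : Set where
  dominance        : sort xs ⊴ sort ys → squares xs < squares ys → xs ⊏ ys
  fewer-inversions : sort xs ≡ sort ys → inversions ys < inversions xs → xs ⊏ ys

_⊑_ : List ℕ → List ℕ → Set
xs ⊑ ys = xs ⊏ ys ⊎ xs ≡ ys

⊏-trans : ∀ {xs ys zs} → xs ⊏ ys → ys ⊏ zs → xs ⊏ zs
⊏-trans (dominance d s) (dominance d′ s′) = dominance (⊴-trans d d′) (<-trans s s′)
⊏-trans {xs} {ys} {zs} (dominance d s) (fewer-inversions e _) =
  dominance (subst (sort xs ⊴_) e d) (<-≤-trans s (≤-reflexive (squares-↭ (sort-≡⇒↭ ys zs e))))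
⊏-trans {xs} {ys} {zs} (fewer-inversions e _) (dominance d s) =
  dominance (subst (_⊴ sort zs) (sym e) d) (≤-<-trans (≤-reflexive (squares-↭ (sort-≡⇒↭ xs ys e))) s)
⊏-trans (fewer-inversions e i) (fewer-inversions e′ i′) = fewer-inversions (trans e e′) (<-trans i′ i)

⊑-⊏-trans : ∀ {xs ys zs} → xs ⊑ ys → ys ⊏ zs → xs ⊏ zs
⊑-⊏-trans (inj₁ xs⊏ys) ys⊏zs = ⊏-trans xs⊏ys ys⊏zs
⊑-⊏-trans (inj₂ refl) ys⊏zs = ys⊏zs

∷-mono-⊏ : ∀ z {xs ys} → xs ⊏ ys → z ∷ xs ⊏ z ∷ ys
∷-mono-⊏ z {xs} {ys} (dominance d s) =
  dominance (insert-mono-⊴ z (sort-↗ xs) (sort-↗ ys) d) (+-monoʳ-< (z * z) s)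
∷-mono-⊏ z {xs} {ys} (fewer-inversions e i) = fewer-inversions (cong (insert z) e)
  (subst (λ a → a + inversions ys < above z xs + inversions xs)
         (above-↭ (sort-≡⇒↭ xs ys e)) (+-monoʳ-< (above z xs) i))

∷-mono-⊑ : ∀ z {xs ys} → xs ⊑ ys → z ∷ xs ⊑ z ∷ ys
∷-mono-⊑ z (inj₁ xs⊏ys) = inj₁ (∷-mono-⊏ z xs⊏ys)
∷-mono-⊑ z (inj₂ refl) = inj₂ refl

squares-transfer : ∀ {A B} z → B < A → A * A + (suc B * suc B + z) < suc A * suc A + (B * B + z)
squares-transfer {A} {B} z B<A =
  subst₂ _<_ (sym (before A B z)) (sym (after A B z)) (+-monoʳ-< (A * A + B * B + z + 1) (+-mono-< B<A B<A))
  where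
  before : ∀ A B z → A * A + (suc B * suc B + z) ≡ A * A + B * B + z + 1 + (B + B)
  before = solve-∀
  after : ∀ A B z → suc A * suc A + (B * B + z) ≡ A * A + B * B + z + 1 + (A + A)
  after = solve-∀

transfer-⊏ : ∀ {A B xs ys} zs → B < A → xs ↭ A ∷ suc B ∷ zs → ys ↭ suc A ∷ B ∷ zs → xs ⊏ ys
transfer-⊏ zs B<A xs↭ ys↭ = dominance
  (subst₂ _⊴_ (sym (sort-cong-↭ xs↭)) (sym (sort-cong-↭ ys↭))
    (insert-transfer-⊴ (<⇒≤ B<A) (sort-↗ zs)))
  (subst₂ _<_ (sym (squares-↭ xs↭)) (sym (squares-↭ ys↭)) (squares-transfer (squares zs) B<A))

swap-⊏ : ∀ x M R → x ∷ M ++ suc x ∷ R ⊏ suc x ∷ M ++ x ∷ R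
swap-⊏ x M R = fewer-inversions same-sort (inversions-swap (n<1+n x) M R)
  where
  same-sort : sort (x ∷ M ++ suc x ∷ R) ≡ sort (suc x ∷ M ++ x ∷ R)
  same-sort = sort-cong-↭ (↭-trans (∷-shift x (suc x) M R)
                          (↭-trans (swap (suc x) x ↭-refl) (↭-sym (∷-shift (suc x) x M R))))

raise : ∀ {n} → Vec ℕ n → Subset n → Vec ℕ n
raise [] [] = []
raise (x ∷ q) (b ∷ S) = (if b then suc x else x) ∷ raise q S

-- The first k indices of π(q): ties are broken by index, so the first index is among them iff
-- fewer than k later exponents are strictly larger.
top : ∀ {n} → Vec ℕ n → ℕ → Subset n
top [] k = []
top (x ∷ q) k = if above x (toList q) <ᵇ k then true ∷ top q (pred k) else false ∷ top q k

above-≤-length : ∀ {n} x (q : Vec ℕ n) → above x (toList q) ≤ n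
above-≤-length x q = ≤-trans (length-filter (x <?_) (toList q)) (≤-reflexive (length-toList q))

raise-top-in : ∀ {n y k} (q : Vec ℕ n) → above y (toList q) < k →
  toList (raise (y ∷ q) (top (y ∷ q) k)) ≡ suc y ∷ toList (raise q (top q (pred k)))
raise-top-in q c<k rewrite <ᵇ-true c<k = refl

raise-top-out : ∀ {n y k} (q : Vec ℕ n) → k ≤ above y (toList q) →
  toList (raise (y ∷ q) (top (y ∷ q) k)) ≡ y ∷ toList (raise q (top q k))
raise-top-out q k≤c rewrite <ᵇ-false k≤c = refl

∣top∣ : ∀ {n} (q : Vec ℕ n) {k} → k ≤ n → ∣ top q k ∣ ≡ k
∣top∣ [] z≤n = refl
∣top∣ (x ∷ q) {k} k≤n with above x (toList q) <? k
∣top∣ (x ∷ q) {suc k} k≤n | yes c<k rewrite <ᵇ-true c<k = cong suc (∣top∣ q (≤-pred k≤n))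
∣top∣ (x ∷ q) {k} k≤n | no c≮k rewrite <ᵇ-false (≮⇒≥ c≮k) =
  ∣top∣ q (≤-trans (≮⇒≥ c≮k) (above-≤-length x q))

-- v is the (k+1)-th largest entry of q, and top q (suc k) adds its index to top q k.
record TopStep {n} (q : Vec ℕ n) (k : ℕ) : Set where
  field
    before after : List ℕ
    v : ℕ
    raise-top-suc : toList (raise q (top q (suc k))) ≡ before ++ suc v ∷ after
    raise-top     : toList (raise q (top q k)) ≡ before ++ v ∷ after
    above-v       : above v (toList q) ≤ k
    v-least       : ∀ {x} → above x (toList q) ≤ k → v ≤ x

  above>k⇒<v : ∀ {x} → k < above x (toList q) → x < v
  above>k⇒<v k<c = ≰⇒> (λ v≤x → ≤⇒≯ (≤-trans (above-anti (toList q) v≤x) above-v) k<c)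

topStep-in : ∀ {n y k} {q : Vec ℕ n} → above y (toList q) ≤ k → TopStep q k → TopStep (y ∷ q) (suc k)
topStep-in {y = y} {k} {q} c≤k step = record
  { before = suc y ∷ before
  ; after = after
  ; v = v
  ; raise-top-suc = trans (raise-top-in q (m≤n⇒m≤1+n (s≤s c≤k))) (cong (suc y ∷_) raise-top-suc)
  ; raise-top = trans (raise-top-in q (s≤s c≤k)) (cong (suc y ∷_) raise-top)
  ; above-v = subst (_≤ suc k) (sym (above-∷ v y (toList q))) (+-mono-≤ (⟦<⟧-≤1 v y) above-v)
  ; v-least = least
  }
  where
  open TopStep step
  least : ∀ {x} → above x (y ∷ toList q) ≤ suc k → v ≤ x
  least {x} c′≤k rewrite above-∷ x y (toList q) with x <? y
  ... | yes x<y rewrite <ᵇ-true x<y = v-least (≤-pred c′≤k)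
  ... | no x≮y = ≤-trans (v-least c≤k) (≮⇒≥ x≮y)

topStep-at : ∀ {n y k} {q : Vec ℕ n} → above y (toList q) ≡ k → TopStep (y ∷ q) k
topStep-at {y = y} {k} {q} c≡k = record
  { before = []
  ; after = toList (raise q (top q k))
  ; v = y
  ; raise-top-suc = raise-top-in q (s≤s (≤-reflexive c≡k))
  ; raise-top = raise-top-out q (≤-reflexive (sym c≡k))
  ; above-v = ≤-reflexive (trans (above-∷-≤ (toList q) ≤-refl) c≡k)
  ; v-least = least
  }
  where
  least : ∀ {x} → above x (y ∷ toList q) ≤ k → y ≤ x
  least {x} c′≤k rewrite above-∷ x y (toList q) with x <? y
  ... | no x≮y = ≮⇒≥ x≮y
  ... | yes x<y rewrite <ᵇ-true x<y =
    contradiction c′≤k (≤⇒≯ (subst (_≤ above x (toList q)) c≡k (above-anti (toList q) (<⇒≤ x<y))))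

topStep-out : ∀ {n y k} {q : Vec ℕ n} → k < above y (toList q) → TopStep q k → TopStep (y ∷ q) k
topStep-out {y = y} {k} {q} k<c step = record
  { before = y ∷ before
  ; after = after
  ; v = v
  ; raise-top-suc = trans (raise-top-out q k<c) (cong (y ∷_) raise-top-suc)
  ; raise-top = trans (raise-top-out q (<⇒≤ k<c)) (cong (y ∷_) raise-top)
  ; above-v = ≤-trans (≤-reflexive (above-∷-≤ (toList q) (<⇒≤ (above>k⇒<v k<c)))) above-v
  ; v-least = λ {x} c′≤k →
      v-least (m+n≤o⇒n≤o ⟦ x < y ⟧ (subst (_≤ k) (above-∷ x y (toList q)) c′≤k))
  }
  where open TopStep step

topStep : ∀ {n} (q : Vec ℕ n) k → k < n → TopStep q k
topStep (y ∷ q) k k<n with <-cmp (above y (toList q)) k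
topStep (y ∷ q) (suc k) k<n | tri< c<k _ _ = topStep-in (≤-pred c<k) (topStep q k (≤-pred k<n))
... | tri≈ _ c≡k _ = topStep-at c≡k
... | tri> _ _ k<c = topStep-out k<c (topStep q k (<-≤-trans k<c (above-≤-length y q)))

move-to-head-⊏ : ∀ {x v} M R → v ≤ x → x ∷ M ++ suc v ∷ R ⊏ suc x ∷ M ++ v ∷ R
move-to-head-⊏ {x} {v} M R v≤x with m≤n⇒m<n∨m≡n v≤x
... | inj₁ v<x = transfer-⊏ (M ++ R) v<x (prep x (shift (suc v) M R)) (prep (suc x) (shift v M R))
... | inj₂ refl = swap-⊏ v M R

move-from-head-⊏ : ∀ {x v} M R → x < v → suc x ∷ M ++ v ∷ R ⊏ x ∷ M ++ suc v ∷ R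
move-from-head-⊏ {x} {v} M R x<v = transfer-⊏ (M ++ R) x<v (∷-shift (suc x) v M R) (∷-shift x (suc v) M R)

raise-top-⊏-raise-head : ∀ {n x k} (q : Vec ℕ n) → above x (toList q) ≤ k → k < n →
  x ∷ toList (raise q (top q (suc k))) ⊏ suc x ∷ toList (raise q (top q k))
raise-top-⊏-raise-head {x = x} {k} q c≤k k<n =
  subst₂ _⊏_ (cong (x ∷_) (sym raise-top-suc)) (cong (suc x ∷_) (sym raise-top))
    (move-to-head-⊏ before after (v-least c≤k))
  where open TopStep (topStep q k k<n)

raise-head-⊏-raise-top : ∀ {n x k} (q : Vec ℕ n) → k < above x (toList q) →
  suc x ∷ toList (raise q (top q k)) ⊏ x ∷ toList (raise q (top q (suc k)))
raise-head-⊏-raise-top {x = x} {k} q k<c =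
  subst₂ _⊏_ (cong (suc x ∷_) (sym raise-top)) (cong (x ∷_) (sym raise-top-suc))
    (move-from-head-⊏ before after (above>k⇒<v k<c))
  where open TopStep (topStep q k (<-≤-trans k<c (above-≤-length x q)))

raise-⊑-raise-top : ∀ {n} (q : Vec ℕ n) S {k} → ∣ S ∣ ≡ k →
  toList (raise q S) ⊑ toList (raise q (top q k))
raise-⊑-raise-top [] [] _ = inj₂ refl
raise-⊑-raise-top (x ∷ q) (true ∷ S) refl with above x (toList q) <? suc ∣ S ∣
... | yes c<k rewrite raise-top-in {y = x} q c<k = ∷-mono-⊑ (suc x) (raise-⊑-raise-top q S refl)
... | no c≮k rewrite raise-top-out {y = x} q (≮⇒≥ c≮k) =
  inj₁ (⊑-⊏-trans (∷-mono-⊑ (suc x) (raise-⊑-raise-top q S refl))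
                  (raise-head-⊏-raise-top q (≮⇒≥ c≮k)))
raise-⊑-raise-top (x ∷ q) (false ∷ S) {k} eq with above x (toList q) <? k
... | no c≮k rewrite raise-top-out {y = x} q (≮⇒≥ c≮k) = ∷-mono-⊑ x (raise-⊑-raise-top q S eq)
raise-⊑-raise-top (x ∷ q) (false ∷ S) {suc k} eq | yes c<k rewrite raise-top-in {y = x} q c<k =
  inj₁ (⊑-⊏-trans (∷-mono-⊑ x (raise-⊑-raise-top q S eq))
                  (raise-top-⊏-raise-head q (≤-pred c<k) (subst (_≤ _) eq (∣p∣≤n S))))

toList-tabulate-suc : ∀ n → toList (tabulate {n = n} Fin.suc) ≡ map Fin.suc (allIdx n)
toList-tabulate-suc n = trans (cong toList (tabulate-∘ Fin.suc id)) (toList-map Fin.suc (tabulate id))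

insIdx-map-suc : ∀ {n} x (q : Vec ℕ n) i js →
  insIdx (x ∷ q) (Fin.suc i) (map Fin.suc js) ≡ map Fin.suc (insIdx q i js)
insIdx-map-suc x q i [] = refl
insIdx-map-suc x q i (j ∷ js) with lookup q j ≤ᵇ lookup q i
... | true = refl
... | false = cong (Fin.suc j ∷_) (insIdx-map-suc x q i js)

indexPerm-∷ : ∀ {n} x (q : Vec ℕ n) →
  indexPerm (x ∷ q) ≡ insIdx (x ∷ q) Fin.zero (map Fin.suc (indexPerm q))
indexPerm-∷ {n} x q = cong (insIdx (x ∷ q) Fin.zero) (begin
  foldr (insIdx (x ∷ q)) [] (toList (tabulate Fin.suc))
    ≡⟨ cong (foldr (insIdx (x ∷ q)) []) (toList-tabulate-suc n) ⟩
  foldr (insIdx (x ∷ q)) [] (map Fin.suc (allIdx n))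
    ≡⟨ foldr-map (insIdx (x ∷ q)) Fin.suc [] (allIdx n) ⟩
  foldr (λ i → insIdx (x ∷ q) (Fin.suc i)) [] (allIdx n)
    ≡⟨ foldr-fusion (map Fin.suc) [] (λ i js → sym (insIdx-map-suc x q i js)) (allIdx n) ⟨
  map Fin.suc (indexPerm q)
    ∎)
  where open ≡-Reasoning

map-lookup-insIdx : ∀ {n} x (q : Vec ℕ n) js →
  map (lookup (x ∷ q)) (insIdx (x ∷ q) Fin.zero (map Fin.suc js)) ≡ insert x (map (lookup q) js)
map-lookup-insIdx x q [] = refl
map-lookup-insIdx x q (j ∷ js) with lookup q j ≤ᵇ x
... | true = cong (λ l → x ∷ lookup q j ∷ l) (sym (map-∘ js))
... | false = cong (lookup q j ∷_) (map-lookup-insIdx x q js)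

expPart-sort : ∀ {n} (q : Vec ℕ n) → expPart q ≡ sort (toList q)
expPart-sort [] = refl
expPart-sort (x ∷ q) = begin
  map (lookup (x ∷ q)) (indexPerm (x ∷ q))
    ≡⟨ cong (map (lookup (x ∷ q))) (indexPerm-∷ x q) ⟩
  map (lookup (x ∷ q)) (insIdx (x ∷ q) Fin.zero (map Fin.suc (indexPerm q)))
    ≡⟨ map-lookup-insIdx x q (indexPerm q) ⟩
  insert x (expPart q)
    ≡⟨ cong (insert x) (expPart-sort q) ⟩
  insert x (sort (toList q))
    ∎
  where open ≡-Reasoning

leadingAbove : ℕ → List ℕ → ℕ
leadingAbove x [] = 0
leadingAbove x (y ∷ ys) = if y ≤ᵇ x then 0 else suc (leadingAbove x ys)

leadingAbove-sorted : ∀ x {ys} → Sorted ys → leadingAbove x ys ≡ above x ys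
leadingAbove-sorted x [] = refl
leadingAbove-sorted x {y ∷ ys} s with y ≤? x
... | yes y≤x rewrite ≤ᵇ-true y≤x =
  sym (cong length (filter-none (x <?_) (All.map ≤⇒≯ (Linked⇒All ≥-trans y≤x s))))
... | no y≰x rewrite ≤ᵇ-false (≰⇒> y≰x) | above-∷ x y ys | <ᵇ-true (≰⇒> y≰x) =
  cong suc (leadingAbove-sorted x (Linked.tail s))

leadingAbove-expPart : ∀ {n} x (q : Vec ℕ n) → leadingAbove x (expPart q) ≡ above x (toList q)
leadingAbove-expPart x q = begin
  leadingAbove x (expPart q)         ≡⟨ cong (leadingAbove x) (expPart-sort q) ⟩
  leadingAbove x (sort (toList q))   ≡⟨ leadingAbove-sorted x (sort-↗ (toList q)) ⟩
  above x (sort (toList q))          ≡⟨ above-↭ (sort-↭ (toList q)) ⟩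
  above x (toList q)                 ∎
  where open ≡-Reasoning

below : ∀ {n} → Fin n → List (Fin n) → ℕ
below t js = length (filter (_<ᶠ? t) js)

below-map-suc : ∀ {n} (t : Fin n) js → below (Fin.suc t) (map Fin.suc js) ≡ below t js
below-map-suc t [] = refl
below-map-suc t (j ∷ js) with does (j <ᶠ? t)
... | true = cong suc (below-map-suc t js)
... | false = below-map-suc t js

below-↭ : ∀ {n} {t : Fin n} {js ks} → js ↭ ks → below t js ≡ below t ks
below-↭ {t = t} js↭ks = ↭-length (filter-↭ (_<ᶠ? t) js↭ks)

below-zero : ∀ {n} (js : List (Fin (suc n))) → below Fin.zero js ≡ 0
below-zero [] = refl
below-zero (j ∷ js) = below-zero js

insIdx-↭ : ∀ {n} (m : Monomial n) i js → insIdx m i js ↭ i ∷ js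
insIdx-↭ m i [] = ↭-refl
insIdx-↭ m i (j ∷ js) with lookup m j ≤ᵇ lookup m i
... | true = ↭-refl
... | false = ↭-trans (prep j (insIdx-↭ m i js)) (swap j i ↭-refl)

inv-map-suc : ∀ {n} (js : List (Fin n)) → inv (map Fin.suc js) ≡ inv js
inv-map-suc [] = refl
inv-map-suc (j ∷ js) = cong₂ _+_ (below-map-suc j js) (inv-map-suc js)

inv-insIdx-head : ∀ {n} x (q : Vec ℕ n) js →
  inv (insIdx (x ∷ q) Fin.zero (map Fin.suc js)) ≡ inv js + leadingAbove x (map (lookup q) js)
inv-insIdx-head x q [] = refl
inv-insIdx-head x q (j ∷ js) with lookup q j ≤ᵇ x
... | true = trans (cong₂ _+_ (below-zero (map Fin.suc (j ∷ js))) (inv-map-suc (j ∷ js))) (sym (+-identityʳ _))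
... | false = begin
  below (Fin.suc j) rest + inv rest                     ≡⟨ cong₂ _+_ below-rest (inv-insIdx-head x q js) ⟩
  suc (below j js) + (inv js + L)                       ≡⟨ cong suc (+-assoc (below j js) (inv js) L) ⟨
  suc (below j js + inv js + L)                         ≡⟨ +-suc (below j js + inv js) L ⟨
  below j js + inv js + suc L                           ∎
  where
  open ≡-Reasoning
  rest = insIdx (x ∷ q) Fin.zero (map Fin.suc js)
  L = leadingAbove x (map (lookup q) js)
  below-rest : below (Fin.suc j) rest ≡ suc (below j js)
  below-rest = trans (below-↭ (insIdx-↭ (x ∷ q) Fin.zero (map Fin.suc js))) (cong suc (below-map-suc j js))

inv-indexPerm : ∀ {n} (q : Vec ℕ n) → inv (indexPerm q) ≡ inversions (toList q)
inv-indexPerm [] = refl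
inv-indexPerm (x ∷ q) = begin
  inv (indexPerm (x ∷ q))
    ≡⟨ cong inv (indexPerm-∷ x q) ⟩
  inv (insIdx (x ∷ q) Fin.zero (map Fin.suc (indexPerm q)))
    ≡⟨ inv-insIdx-head x q (indexPerm q) ⟩
  inv (indexPerm q) + leadingAbove x (expPart q)
    ≡⟨ cong₂ _+_ (inv-indexPerm q) (leadingAbove-expPart x q) ⟩
  inversions (toList q) + above x (toList q)
    ≡⟨ +-comm (inversions (toList q)) _ ⟩
  above x (toList q) + inversions (toList q)
    ∎
  where open ≡-Reasoning

xList-map-suc : ∀ {n} (is : List (Fin n)) → xList (map Fin.suc is) ≡ 0 ∷ xList is
xList-map-suc [] = refl
xList-map-suc (i ∷ is) = cong (_[ Fin.suc i ]%= suc) (xList-map-suc is)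

xList-take-insIdx-head : ∀ {n} x (q : Vec ℕ n) js k →
  xList (take k (insIdx (x ∷ q) Fin.zero (map Fin.suc js))) ≡
  (if leadingAbove x (map (lookup q) js) <ᵇ k then 1 ∷ xList (take (pred k) js) else 0 ∷ xList (take k js))
xList-take-insIdx-head x q js zero = refl
xList-take-insIdx-head {n} x q [] (suc k) rewrite take-[] {A = Fin (suc n)} k | take-[] {A = Fin n} k = refl
xList-take-insIdx-head x q (j ∷ js) (suc k) with lookup q j ≤ᵇ x
... | true = cong (_[ Fin.zero ]%= suc)
  (trans (cong xList (take-map k (j ∷ js))) (xList-map-suc (take k (j ∷ js))))
... | false = trans (cong (_[ Fin.suc j ]%= suc) (xList-take-insIdx-head x q js k))
                    (step (leadingAbove x (map (lookup q) js)) k)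
  where
  step : ∀ L k →
    (if L <ᵇ k then 1 ∷ xList (take (pred k) js) else 0 ∷ xList (take k js)) [ Fin.suc j ]%= suc ≡
    (if L <ᵇ k then 1 ∷ xList (take k (j ∷ js)) else 0 ∷ xList (take (suc k) (j ∷ js)))
  step L zero = refl
  step L (suc k) with L <ᵇ suc k
  ... | true = refl
  ... | false = refl

xList-take-indexPerm : ∀ {n} (q : Vec ℕ n) k → xList (take k (indexPerm q)) ≡ xSub (top q k)
xList-take-indexPerm [] k rewrite take-[] {A = Fin 0} k = refl
xList-take-indexPerm (x ∷ q) k
  rewrite indexPerm-∷ x q | xList-take-insIdx-head x q (indexPerm q) k | leadingAbove-expPart x q
  with above x (toList q) <ᵇ k
... | true = cong (1 ∷_) (xList-take-indexPerm q (pred k))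
... | false = cong (0 ∷_) (xList-take-indexPerm q k)

·-xSub : ∀ {n} (m : Monomial n) S → m · xSub S ≡ raise m S
·-xSub [] [] = refl
·-xSub (x ∷ m) (true ∷ S) = cong₂ _∷_ (+-comm x 1) (·-xSub m S)
·-xSub (x ∷ m) (false ∷ S) = cong₂ _∷_ (+-identityʳ x) (·-xSub m S)

deg-raise : ∀ {n} (m : Monomial n) S → deg (raise m S) ≡ deg m + ∣ S ∣
deg-raise [] [] = refl
deg-raise (x ∷ m) (true ∷ S) = begin
  suc x + deg (raise m S)      ≡⟨ cong (suc x +_) (deg-raise m S) ⟩
  suc (x + (deg m + ∣ S ∣))    ≡⟨ cong suc (+-assoc x (deg m) ∣ S ∣) ⟨
  suc (x + deg m + ∣ S ∣)      ≡⟨ +-suc (x + deg m) ∣ S ∣ ⟨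
  x + deg m + suc ∣ S ∣        ∎
  where open ≡-Reasoning
deg-raise (x ∷ m) (false ∷ S) = trans (cong (x +_) (deg-raise m S)) (sym (+-assoc x (deg m) ∣ S ∣))

⊏⇒≺ : ∀ {n} {q q′ : Monomial n} → deg q ≡ deg q′ → toList q ⊏ toList q′ → q ≺ q′
⊏⇒≺ {q = q} {q′} d (dominance dom s) =
  d , inj₁ (subst₂ _⊴_ (sym (expPart-sort q)) (sym (expPart-sort q′)) dom , distinct)
  where
  distinct : expPart q ≢ expPart q′
  distinct e = <-irrefl (squares-↭ (sort-≡⇒↭ (toList q) (toList q′)
    (trans (sym (expPart-sort q)) (trans e (expPart-sort q′))))) s
⊏⇒≺ {q = q} {q′} d (fewer-inversions e i) = d , inj₂
  ( trans (expPart-sort q) (trans e (sym (expPart-sort q′)))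
  , subst₂ _<_ (sym (inv-indexPerm q′)) (sym (inv-indexPerm q)) i)

toList-injective-≡ : ∀ {n} {xs ys : Vec ℕ n} → toList xs ≡ toList ys → xs ≡ ys
toList-injective-≡ {xs = xs} eq = trans (sym (cast-is-id refl xs)) (toList-injective refl xs _ eq)

lemma3p2 : (n : ℕ) (m : Monomial n) (k : ℕ) → 1 ≤ k → k ≤ n →
    InSk m k (mk m k) ×
    ((m′ : Monomial n) → InSk m k m′ → m′ ≢ mk m k → m′ ≺ mk m k)
lemma3p2 n m k _ k≤n = (top m k , ∣top∣ m k≤n , mk≡) , below-mk
  where
  mk≡ : mk m k ≡ m · xSub (top m k)
  mk≡ = cong (m ·_) (xList-take-indexPerm m k)

  mk≡raise : mk m k ≡ raise m (top m k)
  mk≡raise = trans mk≡ (·-xSub m (top m k))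

  below-mk : (m′ : Monomial n) → InSk m k m′ → m′ ≢ mk m k → m′ ≺ mk m k
  below-mk _ (S , ∣S∣≡k , refl) m′≢mk with raise-⊑-raise-top m S ∣S∣≡k
  ... | inj₂ same = ⊥-elim (m′≢mk (trans (·-xSub m S) (trans (toList-injective-≡ same) (sym mk≡raise))))
  ... | inj₁ S⊏top = subst₂ _≺_ (sym (·-xSub m S)) (sym mk≡raise) (⊏⇒≺ same-deg S⊏top)
    where
    same-deg : deg (raise m S) ≡ deg (raise m (top m k))
    same-deg = begin
      deg (raise m S)               ≡⟨ deg-raise m S ⟩
      deg m + ∣ S ∣                 ≡⟨ cong (deg m +_) (trans ∣S∣≡k (sym (∣top∣ m k≤n))) ⟩
      deg m + ∣ top m k ∣           ≡⟨ deg-raise m (top m k) ⟨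
      deg (raise m (top m k))       ∎
      where open ≡-Reasoning
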